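{- Let $G$ be an unweighted undirected graph on $n$ vertices with minimum cut value $c\geq 1$, and fix a minimum cut $C$ of $G$. If Karger's algorithm is run on $G$ until there are at most $cn$ edges in the (contracted) graph, then with probability bounded below by an absolute positive constant, no edge of $C$ is contracted (i.e., the minimum cut $C$ survives).
   Context: Karger's contraction algorithm: repeatedly pick an edge of the current multigraph uniformly at random and contract its two endpoints into a single super-vertex, keeping multi-edges and removing self-loops. The cut value of a set is the number of edges crossing it; the minimum cut value is the minimum over nonempty proper vertex subsets. -}

module Defs where

open import Data.Bool using (Bool; true; false; if_then_else_; not; _∧_; _xor_)
open import Data.Nat using (ℕ; zero; suc; _*_; _≤ᵇ_; _≤_)
open import Data.Fin using (Fin; _<?_)
import Data.Fin as F
open import Data.List using (List; []; _∷_; length; filterᵇ; concatMap; map; allFin; foldr)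
open import Data.Product using (_×_; _,_; Σ; ∃)
open import Data.Integer using (+_)
open import Data.Rational using (ℚ; 0ℚ; 1ℚ; _/_) renaming (_+_ to _+ℚ_; _*_ to _*ℚ_)
open import Relation.Nullary.Decidable using (⌊_⌋)
open import Relation.Binary.PropositionalEquality using (_≡_)

-- A finite simple undirected graph on vertex set Fin n, given by a Boolean
-- adjacency relation; it is a simple graph when `adj` is symmetric and
-- irreflexive (these are hypotheses of the theorem).
Adj : ℕ → Set
Adj n = Fin n → Fin n → Bool

Edge : ℕ → Set
Edge n = Fin n × Fin n

edges : ∀ {n} → Adj n → List (Edge n)
edges {n} adj =
  concatMap (λ u → map (λ v → (u , v))
    (filterᵇ (λ v → ⌊ u <? v ⌋ ∧ adj u v) (allFin n))) (allFin n)

VSet : ℕ → Set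
VSet n = Fin n → Bool

NonemptyProper : ∀ {n} → VSet n → Set
NonemptyProper S = (∃ λ x → S x ≡ true) × (∃ λ y → S y ≡ false)

crosses : ∀ {n} → VSet n → Edge n → Bool
crosses S (u , v) = S u xor S v

cutValue : ∀ {n} → Adj n → VSet n → ℕ
cutValue adj S = length (filterᵇ (crosses S) (edges adj))

IsMinCut : ∀ {n} → Adj n → VSet n → Set
IsMinCut {n} adj S =
  NonemptyProper S × ((T : VSet n) → NonemptyProper T → cutValue adj S ≤ cutValue adj T)

-- A state is a map φ sending each original vertex to (a representative
-- label of) its current super-vertex. The current multigraph has one edge
-- for every original edge whose endpoints lie in different super-vertices
-- (multi-edges kept, self-loops removed).

Labels : ℕ → Set
Labels n = Fin n → Fin n

currentEdges : ∀ {n} → Adj n → Labels n → List (Edge n)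
currentEdges adj φ = filterᵇ (λ { (u , v) → not ⌊ φ u F.≟ φ v ⌋ }) (edges adj)

contract : ∀ {n} → Labels n → Edge n → Labels n
contract φ (u , v) x = if ⌊ φ x F.≟ φ v ⌋ then φ u else φ x

sumℚ : List ℚ → ℚ
sumℚ = foldr _+ℚ_ 0ℚ

-- Uniform average over a list (the empty case never arises in use).
average : List ℚ → ℚ
average [] = 1ℚ
average xs@(_ ∷ ys) = sumℚ xs *ℚ (+ 1 / suc (length ys))

-- survivalAux adj S t fuel φ : probability that, starting from state φ and
-- repeatedly contracting a uniformly random edge of the current multigraph
-- until it has at most t edges, no edge crossing S is ever contracted.
-- Each contraction removes at least one current edge, so fuel = number of
-- original edges suffices (fuel 0 is only reached with no edges left).
survivalAux : ∀ {n} → Adj n → VSet n → ℕ → ℕ → Labels n → ℚ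
survivalAux adj S t zero φ = 1ℚ
survivalAux adj S t (suc fuel) φ =
  if length (currentEdges adj φ) ≤ᵇ t then 1ℚ
  else average (map (λ e → if crosses S e then 0ℚ
                           else survivalAux adj S t fuel (contract φ e))
                    (currentEdges adj φ))

survivalProb : ∀ {n} → Adj n → VSet n → ℚ
survivalProb {n} adj S =
  survivalAux adj S (cutValue adj S * n) (length (edges adj)) (λ x → x)

module Submission where

-- While more than c·n edges remain, at most c of them cross S, so a uniformly
-- random edge misses the cut with probability at least 1 - c/(c·n) = 1 - 1/n.
-- Each contraction merges two super-vertices, so there are at most n rounds,
-- and the cut survives with probability at least (1 - 1/n)^n ≥ 1/9 (n ≥ 2).
-- Note that only the cut value of S matters, not its minimality.

open import Defs
open import Data.Bool using (false)
open import Data.Nat using (ℕ; _≤_)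
open import Data.Fin using (Fin)
open import Data.Product using (Σ; _×_)
open import Data.Rational using (ℚ; 0ℚ) renaming (_<_ to _<ℚ_; _≤_ to _≤ℚ_)
open import Relation.Binary.PropositionalEquality using (_≡_)

open import Algebra.Bundles using (CommutativeRing; CommutativeMonoid)
open import Data.Bool using (Bool; true; if_then_else_; not; T; T?)
open import Data.Nat using (zero; suc; NonZero; _+_; _*_; _∸_; _<_; _≤ᵇ_; z≤n; s≤s)
import Data.Nat.Properties as ℕP
open import Data.Integer using (+_)
import Data.Integer as ℤ
open import Data.Integer.Solver using () renaming (module +-*-Solver to ℤSolver)
import Data.Rational as ℚ
open import Data.Rational using (1ℚ)
import Data.Rational.Properties as ℚP
import Data.Rational.Unnormalised as ℚᵘ
import Data.Rational.Unnormalised.Properties as ℚᵘP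
open import Data.Rational.Solver using () renaming (module +-*-Solver to ℚSolver)
open import Data.Product using (_,_; proj₁; proj₂)
open import Data.Fin as F using ()
open import Data.List using ([]; _∷_; length; filter; filterᵇ; map; allFin)
import Data.List.Properties as LP
open import Data.List.Relation.Unary.All using (All; []; _∷_)
import Data.List.Relation.Unary.All as All
open import Data.List.Relation.Unary.All.Properties using (all-filter)
open import Data.List.Membership.Propositional using (_∈_)
open import Data.List.Membership.Propositional.Properties using (∈-allFin; ∈-filter⁺; ∈-filter⁻)
open import Data.List.Relation.Binary.Sublist.Propositional using (_⊆_; ⊆-refl)
import Data.List.Relation.Binary.Sublist.Propositional.Properties as Sublist
import Data.List.Relation.Binary.Sublist.Heterogeneous.Properties as Sublistʰ
open import Data.List.Relation.Binary.Pointwise using (Pointwise-≡⇒≡)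
open import Function using (_∘_; id)
open import Level using (0ℓ)
open import Relation.Binary.PropositionalEquality using (_≢_; refl; sym; trans; cong; cong₂; subst; module ≡-Reasoning)
open import Relation.Nullary using (¬_; Dec; yes; no; contradiction)
open import Relation.Nullary.Decidable using (⌊_⌋; toWitnessFalse)
open import Relation.Unary using (Pred; Decidable)

open CommutativeRing ℚP.+-*-commutativeRing using (semiring)
open import Algebra.Properties.Semiring.Mult semiring using (×-homo-+; ×1-homo-*) renaming (_×_ to _·_)
open import Algebra.Properties.Semiring.Exp semiring using (_^_; ^-homo-*)
open import Algebra.Properties.CommutativeSemigroup
  (CommutativeMonoid.commutativeSemigroup ℚP.*-1-commutativeMonoid)
  using () renaming (interchange to *-interchange)

*-nonneg : ∀ {p q} → 0ℚ ≤ℚ p → 0ℚ ≤ℚ q → 0ℚ ≤ℚ p ℚ.* q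
*-nonneg {p} {q} 0≤p 0≤q = ℚP.nonNegative⁻¹ _
  {{ℚP.nonNeg*nonNeg⇒nonNeg p {{ℚ.nonNegative 0≤p}} q {{ℚ.nonNegative 0≤q}}}}

*-monoˡ : ∀ {p q} r → 0ℚ ≤ℚ r → p ≤ℚ q → r ℚ.* p ≤ℚ r ℚ.* q
*-monoˡ r 0≤r = ℚP.*-monoˡ-≤-nonNeg r {{ℚ.nonNegative 0≤r}}

*-monoʳ : ∀ {p q} r → 0ℚ ≤ℚ r → p ≤ℚ q → p ℚ.* r ≤ℚ q ℚ.* r
*-monoʳ r 0≤r = ℚP.*-monoʳ-≤-nonNeg r {{ℚ.nonNegative 0≤r}}

≤-+-nonneg : ∀ p {q} → 0ℚ ≤ℚ q → p ≤ℚ p ℚ.+ q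
≤-+-nonneg p {q} 0≤q = subst (_≤ℚ p ℚ.+ q) (ℚP.+-identityʳ p) (ℚP.+-monoʳ-≤ p 0≤q)

0≤1 : 0ℚ ≤ℚ 1ℚ
0≤1 = ℚP.nonNegative⁻¹ 1ℚ

⟦_⟧ : ℕ → ℚ
⟦ k ⟧ = k · 1ℚ

⟦⟧-+ : ∀ a b → ⟦ a + b ⟧ ≡ ⟦ a ⟧ ℚ.+ ⟦ b ⟧
⟦⟧-+ = ×-homo-+ 1ℚ

⟦⟧-* : ∀ a b → ⟦ a * b ⟧ ≡ ⟦ a ⟧ ℚ.* ⟦ b ⟧
⟦⟧-* = ×1-homo-*

⟦⟧-nonneg : ∀ a → 0ℚ ≤ℚ ⟦ a ⟧
⟦⟧-nonneg zero = ℚP.≤-refl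
⟦⟧-nonneg (suc a) = ℚP.≤-trans (⟦⟧-nonneg a)
  (subst (_≤ℚ ⟦ suc a ⟧) (ℚP.+-identityˡ ⟦ a ⟧) (ℚP.+-monoˡ-≤ ⟦ a ⟧ 0≤1))

⟦⟧-mono : ∀ {a b} → a ≤ b → ⟦ a ⟧ ≤ℚ ⟦ b ⟧
⟦⟧-mono {a} {b} a≤b = begin
  ⟦ a ⟧                   ≤⟨ ≤-+-nonneg ⟦ a ⟧ (⟦⟧-nonneg (b ∸ a)) ⟩
  ⟦ a ⟧ ℚ.+ ⟦ b ∸ a ⟧     ≡⟨ ⟦⟧-+ a (b ∸ a) ⟨
  ⟦ a + (b ∸ a) ⟧         ≡⟨ cong ⟦_⟧ (ℕP.m+[n∸m]≡n a≤b) ⟩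
  ⟦ b ⟧                   ∎
  where open ℚP.≤-Reasoning

toℚᵘ-⟦⟧ : ∀ k → ℚ.toℚᵘ ⟦ k ⟧ ℚᵘ.≃ ℚᵘ.mkℚᵘ (+ k) 0
toℚᵘ-⟦⟧ zero = ℚᵘP.≃-refl
toℚᵘ-⟦⟧ (suc k) = ℚᵘP.≃-trans (ℚP.toℚᵘ-homo-+ 1ℚ ⟦ k ⟧)
  (ℚᵘP.≃-trans (ℚᵘP.+-congʳ ℚᵘ.1ℚᵘ (toℚᵘ-⟦⟧ k)) (ℚᵘ.*≡* numerators))
  where
  open ℤSolver using (solve; _:+_; _:*_; _:=_; con)
  numerators : (+ 1 ℤ.* + 1 ℤ.+ + k ℤ.* + 1) ℤ.* + 1 ≡ (+ 1 ℤ.+ + k) ℤ.* (+ 1 ℤ.* + 1)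
  numerators = solve 1 (λ x → (con (+ 1) :* con (+ 1) :+ x :* con (+ 1)) :* con (+ 1)
                            := (con (+ 1) :+ x) :* (con (+ 1) :* con (+ 1))) refl (+ k)

recip : (d : ℕ) → .{{NonZero d}} → ℚ
recip d = + 1 ℚ./ d

recip-positive : ∀ d .{{_ : NonZero d}} → 0ℚ <ℚ recip d
recip-positive d = ℚP.positive⁻¹ (recip d) {{ℚP.normalize-pos 1 d}}

⟦⟧*recip : ∀ d .{{_ : NonZero d}} → ⟦ d ⟧ ℚ.* recip d ≡ 1ℚ
⟦⟧*recip (suc k) = ℚP.toℚᵘ-injective (ℚᵘP.≃-trans (ℚP.toℚᵘ-homo-* ⟦ suc k ⟧ (recip (suc k)))
  (ℚᵘP.≃-trans (ℚᵘP.*-cong (toℚᵘ-⟦⟧ (suc k)) (ℚP.toℚᵘ-fromℚᵘ (ℚᵘ.mkℚᵘ (+ 1) k)))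
    (ℚᵘ.*≡* (cong +_ cross))))
  where
  cross : suc k * 1 * 1 ≡ 1 * (1 * suc k)
  cross = trans (ℕP.*-identityʳ (suc k * 1)) (trans (ℕP.*-identityʳ (suc k))
    (sym (trans (ℕP.*-identityˡ (1 * suc k)) (ℕP.*-identityˡ (suc k)))))

recip-nonneg : ∀ d .{{_ : NonZero d}} → 0ℚ ≤ℚ recip d
recip-nonneg d = ℚP.<⇒≤ (recip-positive d)

fraction-nonneg : ∀ a d .{{_ : NonZero d}} → 0ℚ ≤ℚ ⟦ a ⟧ ℚ.* recip d
fraction-nonneg a d = *-nonneg (⟦⟧-nonneg a) (recip-nonneg d)

fraction-≤ : ∀ a b c d .{{_ : NonZero b}} .{{_ : NonZero d}} →
  a * d ≤ c * b → ⟦ a ⟧ ℚ.* recip b ≤ℚ ⟦ c ⟧ ℚ.* recip d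
fraction-≤ a b c d ad≤cb = begin
  ⟦ a ⟧ ℚ.* 1/b                        ≡⟨ ℚP.*-identityʳ _ ⟨
  ⟦ a ⟧ ℚ.* 1/b ℚ.* 1ℚ                 ≡⟨ cong (ℚ._*_ (⟦ a ⟧ ℚ.* 1/b)) (⟦⟧*recip d) ⟨
  ⟦ a ⟧ ℚ.* 1/b ℚ.* (⟦ d ⟧ ℚ.* 1/d)    ≡⟨ *-interchange ⟦ a ⟧ 1/b ⟦ d ⟧ 1/d ⟩
  ⟦ a ⟧ ℚ.* ⟦ d ⟧ ℚ.* (1/b ℚ.* 1/d)    ≡⟨ cong (ℚ._* (1/b ℚ.* 1/d)) (⟦⟧-* a d) ⟨
  ⟦ a * d ⟧ ℚ.* (1/b ℚ.* 1/d)          ≤⟨ *-monoʳ _ (*-nonneg (recip-nonneg b) (recip-nonneg d)) (⟦⟧-mono ad≤cb) ⟩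
  ⟦ c * b ⟧ ℚ.* (1/b ℚ.* 1/d)          ≡⟨ cong₂ ℚ._*_ (⟦⟧-* c b) (ℚP.*-comm 1/b 1/d) ⟩
  ⟦ c ⟧ ℚ.* ⟦ b ⟧ ℚ.* (1/d ℚ.* 1/b)    ≡⟨ *-interchange ⟦ c ⟧ ⟦ b ⟧ 1/d 1/b ⟩
  ⟦ c ⟧ ℚ.* 1/d ℚ.* (⟦ b ⟧ ℚ.* 1/b)    ≡⟨ cong (ℚ._*_ (⟦ c ⟧ ℚ.* 1/d)) (⟦⟧*recip b) ⟩
  ⟦ c ⟧ ℚ.* 1/d ℚ.* 1ℚ                 ≡⟨ ℚP.*-identityʳ _ ⟩
  ⟦ c ⟧ ℚ.* 1/d                        ∎
  where
  open ℚP.≤-Reasoning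
  1/b 1/d : ℚ
  1/b = recip b
  1/d = recip d

complement : ∀ a b {d} .{{_ : NonZero d}} → a + b ≡ d →
  1ℚ ℚ.- ⟦ a ⟧ ℚ.* recip d ≡ ⟦ b ⟧ ℚ.* recip d
complement a b {d} a+b≡d = begin
  1ℚ ℚ.- ⟦ a ⟧ ℚ.* x                    ≡⟨ cong (ℚ._- ⟦ a ⟧ ℚ.* x) (⟦⟧*recip d) ⟨
  ⟦ d ⟧ ℚ.* x ℚ.- ⟦ a ⟧ ℚ.* x           ≡⟨ cong (λ z → ⟦ z ⟧ ℚ.* x ℚ.- ⟦ a ⟧ ℚ.* x) a+b≡d ⟨
  ⟦ a + b ⟧ ℚ.* x ℚ.- ⟦ a ⟧ ℚ.* x       ≡⟨ cong (λ z → z ℚ.* x ℚ.- ⟦ a ⟧ ℚ.* x) (⟦⟧-+ a b) ⟩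
  (⟦ a ⟧ ℚ.+ ⟦ b ⟧) ℚ.* x ℚ.- ⟦ a ⟧ ℚ.* x ≡⟨ solve 3 (λ p q y → (p :+ q) :* y :- p :* y := q :* y) refl ⟦ a ⟧ ⟦ b ⟧ x ⟩
  ⟦ b ⟧ ℚ.* x                           ∎
  where
  open ≡-Reasoning
  open ℚSolver using (solve; _:+_; _:*_; _:-_; _:=_)
  x : ℚ
  x = recip d

survivalRatio : ℕ → ℚ
survivalRatio k = 1ℚ ℚ.- recip (suc k)

survivalRatio-fraction : ∀ k → survivalRatio k ≡ ⟦ k ⟧ ℚ.* recip (suc k)
survivalRatio-fraction k = trans (cong (ℚ._-_ 1ℚ) (sym (ℚP.*-identityˡ (recip (suc k))))) (complement 1 k refl)

survivalRatio-nonneg : ∀ k → 0ℚ ≤ℚ survivalRatio k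
survivalRatio-nonneg k = subst (0ℚ ≤ℚ_) (sym (survivalRatio-fraction k)) (fraction-nonneg k (suc k))

survivalRatio-≤1 : ∀ k → survivalRatio k ≤ℚ 1ℚ
survivalRatio-≤1 k = subst (survivalRatio k ≤ℚ_)
  (solve 1 (λ y → con 1ℚ :- y :+ y := con 1ℚ) refl (recip (suc k)))
  (≤-+-nonneg (survivalRatio k) (recip-nonneg (suc k)))
  where open ℚSolver using (solve; _:+_; _:-_; _:=_; con)

^-nonneg : ∀ {r} → 0ℚ ≤ℚ r → ∀ k → 0ℚ ≤ℚ r ^ k
^-nonneg 0≤r zero = 0≤1
^-nonneg 0≤r (suc k) = *-nonneg 0≤r (^-nonneg 0≤r k)

^-antitone : ∀ {r} → 0ℚ ≤ℚ r → r ≤ℚ 1ℚ → ∀ {j k} → j ≤ k → r ^ k ≤ℚ r ^ j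
^-antitone {r} 0≤r r≤1 {zero} {zero} z≤n = ℚP.≤-refl
^-antitone {r} 0≤r r≤1 {zero} {suc k} z≤n = begin
  r ℚ.* r ^ k    ≤⟨ *-monoʳ (r ^ k) (^-nonneg 0≤r k) r≤1 ⟩
  1ℚ ℚ.* r ^ k   ≡⟨ ℚP.*-identityˡ _ ⟩
  r ^ k          ≤⟨ ^-antitone 0≤r r≤1 {zero} {k} z≤n ⟩
  1ℚ             ∎
  where open ℚP.≤-Reasoning
^-antitone {r} 0≤r r≤1 (s≤s j≤k) = *-monoˡ r 0≤r (^-antitone 0≤r r≤1 j≤k)

^-≤1 : ∀ {r} → 0ℚ ≤ℚ r → r ≤ℚ 1ℚ → ∀ k → r ^ k ≤ℚ 1ℚ
^-≤1 0≤r r≤1 k = ^-antitone 0≤r r≤1 {zero} {k} z≤n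

bernoulli : ∀ {x} → 0ℚ ≤ℚ x → 0ℚ ≤ℚ 1ℚ ℚ.- x → ∀ k → 1ℚ ℚ.- ⟦ k ⟧ ℚ.* x ≤ℚ (1ℚ ℚ.- x) ^ k
bernoulli {x} 0≤x 0≤1-x zero = ℚP.≤-reflexive (cong (ℚ._-_ 1ℚ) (ℚP.*-zeroˡ x))
bernoulli {x} 0≤x 0≤1-x (suc k) = begin
  1ℚ ℚ.- (1ℚ ℚ.+ ⟦ k ⟧) ℚ.* x                           ≤⟨ ≤-+-nonneg _ (*-nonneg (⟦⟧-nonneg k) (*-nonneg 0≤x 0≤x)) ⟩
  1ℚ ℚ.- (1ℚ ℚ.+ ⟦ k ⟧) ℚ.* x ℚ.+ ⟦ k ⟧ ℚ.* (x ℚ.* x)   ≡⟨ factor x ⟦ k ⟧ ⟩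
  (1ℚ ℚ.- x) ℚ.* (1ℚ ℚ.- ⟦ k ⟧ ℚ.* x)                   ≤⟨ *-monoˡ (1ℚ ℚ.- x) 0≤1-x (bernoulli 0≤x 0≤1-x k) ⟩
  (1ℚ ℚ.- x) ℚ.* (1ℚ ℚ.- x) ^ k                          ∎
  where
  open ℚP.≤-Reasoning
  open ℚSolver using (solve; _:+_; _:*_; _:-_; _:=_; con)
  factor : ∀ y z → 1ℚ ℚ.- (1ℚ ℚ.+ z) ℚ.* y ℚ.+ z ℚ.* (y ℚ.* y) ≡ (1ℚ ℚ.- y) ℚ.* (1ℚ ℚ.- z ℚ.* y)
  factor = solve 2 (λ y z → con 1ℚ :- (con 1ℚ :+ z) :* y :+ z :* (y :* y) := (con 1ℚ :- y) :* (con 1ℚ :- z :* y)) refl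

splitIntoThirds : ∀ m → Σ ℕ λ a → Σ ℕ λ b →
  (a + b ≡ suc (suc m)) × (suc (suc m) ≤ a * 3) × (suc (suc m) ≤ b * 3)
splitIntoThirds zero = 1 , 1 , refl , s≤s (s≤s z≤n) , s≤s (s≤s z≤n)
splitIntoThirds (suc zero) = 1 , 2 , refl , s≤s (s≤s (s≤s z≤n)) , s≤s (s≤s (s≤s z≤n))
splitIntoThirds (suc (suc m)) with splitIntoThirds m
... | a , b , a+b≡n , n≤3a , n≤3b =
  suc a , suc b , cong suc (trans (ℕP.+-suc a b) (cong suc a+b≡n)) , grow {a} n≤3a , grow {b} n≤3b
  where
  grow : ∀ {c} → suc (suc m) ≤ c * 3 → suc (suc (suc (suc m))) ≤ suc c * 3
  grow n≤3c = s≤s (s≤s (s≤s (ℕP.<⇒≤ n≤3c)))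

-- If a + b = n and b ≥ n/3, then (1 - 1/n)^a ≥ 1 - a/n = b/n ≥ 1/3.
third≤power : ∀ k a b → a + b ≡ suc k → suc k ≤ b * 3 → recip 3 ≤ℚ survivalRatio k ^ a
third≤power k a b a+b≡n n≤3b = begin
  recip 3                             ≡⟨ ℚP.*-identityˡ _ ⟨
  ⟦ 1 ⟧ ℚ.* recip 3                   ≤⟨ fraction-≤ 1 3 b (suc k) (subst (_≤ b * 3) (sym (ℕP.*-identityˡ _)) n≤3b) ⟩
  ⟦ b ⟧ ℚ.* recip (suc k)             ≡⟨ complement a b a+b≡n ⟨
  1ℚ ℚ.- ⟦ a ⟧ ℚ.* recip (suc k)      ≤⟨ bernoulli (recip-nonneg (suc k)) (survivalRatio-nonneg k) a ⟩
  survivalRatio k ^ a                 ∎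
  where open ℚP.≤-Reasoning

ninth≤survivalRatio^n : ∀ m → recip 9 ≤ℚ survivalRatio (suc m) ^ suc (suc m)
ninth≤survivalRatio^n m with splitIntoThirds m
... | a , b , a+b≡n , n≤3a , n≤3b = begin
  recip 9                                   ≡⟨ refl ⟩
  recip 3 ℚ.* recip 3                       ≤⟨ *-monoʳ (recip 3) (recip-nonneg 3) (third≤power (suc m) a b a+b≡n n≤3b) ⟩
  r ^ a ℚ.* recip 3                         ≤⟨ *-monoˡ (r ^ a) (^-nonneg (survivalRatio-nonneg (suc m)) a) b-part ⟩
  r ^ a ℚ.* r ^ b                           ≡⟨ ^-homo-* r a b ⟨
  r ^ (a + b)                               ≡⟨ cong (r ^_) a+b≡n ⟩
  r ^ suc (suc m)                           ∎
  where
  open ℚP.≤-Reasoning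
  r : ℚ
  r = survivalRatio (suc m)
  b-part : recip 3 ≤ℚ r ^ b
  b-part = third≤power (suc m) b a (trans (ℕP.+-comm b a) a+b≡n) n≤3a

module _ {A : Set} where

  length-partitionᵇ : ∀ (p : A → Bool) xs →
    length xs ≡ length (filterᵇ p xs) + length (filterᵇ (not ∘ p) xs)
  length-partitionᵇ p [] = refl
  length-partitionᵇ p (x ∷ xs) with p x
  ... | true = cong suc (length-partitionᵇ p xs)
  ... | false = trans (cong suc (length-partitionᵇ p xs)) (sym (ℕP.+-suc _ _))

  length-filter-filter : ∀ {P Q : Pred A 0ℓ} (P? : Decidable P) (Q? : Decidable Q) xs →
    length (filter P? (filter Q? xs)) ≤ length (filter P? xs)
  length-filter-filter P? Q? xs =
    Sublist.length-mono-≤ (Sublist.filter⁺ P? P? (λ { refl Px → Px }) (Sublist.filter-⊆ Q? xs))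

  -- A strictly stronger test keeps strictly fewer elements: filter Q? xs is a
  -- sublist of filter P? xs, and misses the witness y, so it is shorter.
  length-filter-< : ∀ {P Q : Pred A 0ℓ} (P? : Decidable P) (Q? : Decidable Q) →
    (∀ {x} → Q x → P x) → ∀ {y xs} → y ∈ xs → P y → ¬ Q y →
    length (filter Q? xs) < length (filter P? xs)
  length-filter-< P? Q? Q⇒P {y} {xs} y∈xs Py ¬Qy =
    ℕP.≤∧≢⇒< (Sublist.length-mono-≤ sub) λ same-length →
      ¬Qy (proj₂ (∈-filter⁻ Q? {xs = xs} (subst (y ∈_) (sym (equal same-length)) (∈-filter⁺ P? y∈xs Py))))
    where
    sub : filter Q? xs ⊆ filter P? xs
    sub = Sublist.filter⁺ Q? P? (λ { refl Qx → Q⇒P Qx }) (⊆-refl {x = xs})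
    equal : length (filter Q? xs) ≡ length (filter P? xs) → filter Q? xs ≡ filter P? xs
    equal eq = Pointwise-≡⇒≡ (Sublistʰ.toPointwise eq sub)

  sum-≥-survivors : ∀ (killed : A → Bool) (h : A → ℚ) {B} xs →
    All (λ x → killed x ≡ false → B ≤ℚ h x) xs →
    ⟦ length (filterᵇ (not ∘ killed) xs) ⟧ ℚ.* B ≤ℚ sumℚ (map (λ x → if killed x then 0ℚ else h x) xs)
  sum-≥-survivors killed h {B} [] [] = ℚP.≤-reflexive (ℚP.*-zeroˡ B)
  sum-≥-survivors killed h {B} (x ∷ xs) (B≤hx ∷ rest) with killed x
  ... | true = subst (_ ≤ℚ_) (sym (ℚP.+-identityˡ _)) (sum-≥-survivors killed h xs rest)
  ... | false = subst (_≤ℚ h x ℚ.+ _) (sym split) (ℚP.+-mono-≤ (B≤hx refl) (sum-≥-survivors killed h xs rest))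
    where
    J : ℚ
    J = ⟦ length (filterᵇ (not ∘ killed) xs) ⟧
    split : (1ℚ ℚ.+ J) ℚ.* B ≡ B ℚ.+ J ℚ.* B
    split = trans (ℚP.*-distribʳ-+ B 1ℚ J) (cong (ℚ._+ J ℚ.* B) (ℚP.*-identityˡ B))

  average-map : ∀ (g : A → ℚ) x xs →
    average (map g (x ∷ xs)) ≡ sumℚ (map g (x ∷ xs)) ℚ.* recip (suc (length xs))
  average-map g x xs = cong (λ m → sumℚ (map g (x ∷ xs)) ℚ.* recip (suc m)) (LP.length-map g xs)

module _ {n : ℕ} where

  -- A labelling is idempotent when each label is the representative of its
  -- own super-vertex; the contraction process preserves this invariant.
  Idempotent : Labels n → Set
  Idempotent φ = ∀ x → φ (φ x) ≡ φ x

  -- The number of super-vertices: the representatives x with φ x = x.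
  classCount : Labels n → ℕ
  classCount φ = length (filter (λ x → φ x F.≟ x) (allFin n))

  classCount-≤ : ∀ φ → classCount φ ≤ n
  classCount-≤ φ = subst (classCount φ ≤_) (LP.length-tabulate id)
    (LP.length-filter (λ x → φ x F.≟ x) (allFin n))

  module Contraction {φ : Labels n} (idem : Idempotent φ) {u v : Fin n} (u≁v : φ u ≢ φ v) where

    ψ : Labels n
    ψ = contract φ (u , v)

    merged : ∀ {x} → φ x ≡ φ v → ψ x ≡ φ u
    merged {x} x~v with φ x F.≟ φ v
    ... | yes _ = refl
    ... | no x≁v = contradiction x~v x≁v

    unchanged : ∀ {x} → φ x ≢ φ v → ψ x ≡ φ x
    unchanged {x} x≁v with φ x F.≟ φ v
    ... | yes x~v = contradiction x~v x≁v
    ... | no _ = refl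

    keeps-representative : ∀ y → φ y ≢ φ v → ψ (φ y) ≡ φ y
    keeps-representative y y≁v = trans (unchanged (λ e → y≁v (trans (sym (idem y)) e))) (idem y)

    contract-idempotent : Idempotent ψ
    contract-idempotent x = by-cases (φ x F.≟ φ v)
      where
      by-cases : Dec (φ x ≡ φ v) → ψ (ψ x) ≡ ψ x
      by-cases (yes x~v) = begin
        ψ (ψ x)  ≡⟨ cong ψ (merged x~v) ⟩
        ψ (φ u)  ≡⟨ keeps-representative u u≁v ⟩
        φ u      ≡⟨ merged x~v ⟨
        ψ x      ∎
        where open ≡-Reasoning
      by-cases (no x≁v) = begin
        ψ (ψ x)  ≡⟨ cong ψ (unchanged x≁v) ⟩
        ψ (φ x)  ≡⟨ keeps-representative x x≁v ⟩
        φ x      ≡⟨ unchanged x≁v ⟨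
        ψ x      ∎
        where open ≡-Reasoning

    representative-before : ∀ {x} → ψ x ≡ x → φ x ≡ x
    representative-before {x} ψx≡x = by-cases (φ x F.≟ φ v)
      where
      by-cases : Dec (φ x ≡ φ v) → φ x ≡ x
      by-cases (yes x~v) = contradiction (trans u~x x~v) u≁v
        where
        u~x : φ u ≡ φ x
        u~x = trans (sym (idem u)) (cong φ (trans (sym (merged x~v)) ψx≡x))
      by-cases (no x≁v) = trans (sym (unchanged x≁v)) ψx≡x

    -- φ v stops being a representative, so the number of classes drops.
    classCount-decreases : classCount ψ < classCount φ
    classCount-decreases =
      length-filter-< (λ x → φ x F.≟ x) (λ x → ψ x F.≟ x) representative-before
        (∈-allFin (φ v)) (idem v) (λ ψv≡v → u≁v (trans (sym (merged (idem v))) ψv≡v))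

-- A pure counting fact behind each round: if M = cc + j with cc ≤ c and
-- c·(k+1) ≤ M, then k·M ≤ j·(k+1), i.e. j/M ≥ k/(k+1).
survivor-count : ∀ k c cc j M → M ≡ cc + j → cc ≤ c → c * suc k ≤ M → k * M ≤ j * suc k
survivor-count k c cc j M M≡cc+j cc≤c c[k+1]≤M = ℕP.+-cancelˡ-≤ M _ _ (begin
  M + k * M             ≡⟨ ℕP.*-comm (suc k) M ⟩
  M * suc k             ≡⟨ cong (_* suc k) M≡cc+j ⟩
  (cc + j) * suc k      ≡⟨ ℕP.*-distribʳ-+ (suc k) cc j ⟩
  cc * suc k + j * suc k ≤⟨ ℕP.+-monoˡ-≤ (j * suc k) (ℕP.*-monoˡ-≤ (suc k) cc≤c) ⟩
  c * suc k + j * suc k  ≤⟨ ℕP.+-monoˡ-≤ (j * suc k) c[k+1]≤M ⟩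
  M + j * suc k          ∎)
  where open ℕP.≤-Reasoning

≤ᵇ-false⇒> : ∀ {m n} → (m ≤ᵇ n) ≡ false → n < m
≤ᵇ-false⇒> m≰ᵇn = ℕP.≰⇒> λ m≤n → subst T m≰ᵇn (ℕP.≤⇒≤ᵇ m≤n)

module Survival {k : ℕ} (adj : Adj (suc k)) (S : VSet (suc k)) where

  r : ℚ
  r = survivalRatio k

  r-nonneg : 0ℚ ≤ℚ r
  r-nonneg = survivalRatio-nonneg k

  r-≤1 : r ≤ℚ 1ℚ
  r-≤1 = survivalRatio-≤1 k

  c : ℕ
  c = cutValue adj S

  t : ℕ
  t = c * suc k

  outcome : (Edge (suc k) → ℚ) → Edge (suc k) → ℚ
  outcome h e = if crosses S e then 0ℚ else h e

  -- With more than t edges of which at most c cross S, a uniformly random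
  -- edge misses the cut with probability j/M ≥ 1 - 1/n = r.
  r≤survivorFraction : ∀ e es → t < suc (length es) → length (filterᵇ (crosses S) (e ∷ es)) ≤ c →
    r ≤ℚ ⟦ length (filterᵇ (not ∘ crosses S) (e ∷ es)) ⟧ ℚ.* recip (suc (length es))
  r≤survivorFraction e es t<M crossing≤c =
    subst (_≤ℚ ⟦ j ⟧ ℚ.* recip M) (sym (survivalRatio-fraction k))
      (fraction-≤ k (suc k) j M
        (survivor-count k c cc j M (length-partitionᵇ (crosses S) (e ∷ es)) crossing≤c (ℕP.<⇒≤ t<M)))
    where
    M cc j : ℕ
    M  = suc (length es)
    cc = length (filterᵇ (crosses S) (e ∷ es))
    j  = length (filterᵇ (not ∘ crosses S) (e ∷ es))

  round-≥ : ∀ e es (h : Edge (suc k) → ℚ) {B} → 0ℚ ≤ℚ B →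
    t < suc (length es) → length (filterᵇ (crosses S) (e ∷ es)) ≤ c →
    All (λ e → crosses S e ≡ false → B ≤ℚ h e) (e ∷ es) →
    r ℚ.* B ≤ℚ average (map (outcome h) (e ∷ es))
  round-≥ e es h {B} 0≤B t<M crossing≤c B≤h = begin
    r ℚ.* B                                   ≤⟨ *-monoʳ B 0≤B (r≤survivorFraction e es t<M crossing≤c) ⟩
    ⟦ j ⟧ ℚ.* recip M ℚ.* B                    ≡⟨ rearrange ⟩
    recip M ℚ.* (⟦ j ⟧ ℚ.* B)                  ≤⟨ *-monoˡ (recip M) (recip-nonneg M) (sum-≥-survivors (crosses S) h (e ∷ es) B≤h) ⟩
    recip M ℚ.* sumℚ (map (outcome h) (e ∷ es)) ≡⟨ ℚP.*-comm (recip M) _ ⟩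
    sumℚ (map (outcome h) (e ∷ es)) ℚ.* recip M ≡⟨ average-map (outcome h) e es ⟨
    average (map (outcome h) (e ∷ es))        ∎
    where
    open ℚP.≤-Reasoning
    M j : ℕ
    M = suc (length es)
    j = length (filterᵇ (not ∘ crosses S) (e ∷ es))
    rearrange : ⟦ j ⟧ ℚ.* recip M ℚ.* B ≡ recip M ℚ.* (⟦ j ⟧ ℚ.* B)
    rearrange = trans (cong (ℚ._* B) (ℚP.*-comm ⟦ j ⟧ (recip M))) (ℚP.*-assoc (recip M) ⟦ j ⟧ B)

  step-≥ : ∀ K es (h : Edge (suc k) → ℚ) → length (filterᵇ (crosses S) es) ≤ c →
    All (λ e → Σ ℕ λ L → L < K × r ^ L ≤ℚ h e) es →
    r ^ K ≤ℚ (if length es ≤ᵇ t then 1ℚ else average (map (outcome h) es))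
  step-≥ K [] h _ _ = ^-≤1 r-nonneg r-≤1 K
  step-≥ zero (e ∷ es) h _ ((_ , () , _) ∷ _)
  step-≥ (suc K) (e ∷ es) h crossing≤c bounds with suc (length es) ≤ᵇ t in M≤ᵇt
  ... | true = ^-≤1 r-nonneg r-≤1 (suc K)
  ... | false = round-≥ e es h (^-nonneg r-nonneg K) (≤ᵇ-false⇒> M≤ᵇt) crossing≤c (All.map lower bounds)
    where
    lower : ∀ {e} → (Σ ℕ λ L → L < suc K × r ^ L ≤ℚ h e) → crosses S e ≡ false → r ^ K ≤ℚ h e
    lower (L , s≤s L≤K , r^L≤h) _ = ℚP.≤-trans (^-antitone r-nonneg r-≤1 L≤K) r^L≤h

  survival-≥ : ∀ fuel φ → Idempotent φ → r ^ classCount φ ≤ℚ survivalAux adj S t fuel φ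
  survival-≥ zero φ _ = ^-≤1 r-nonneg r-≤1 (classCount φ)
  survival-≥ (suc fuel) φ idem =
    step-≥ (classCount φ) (currentEdges adj φ) (λ e → survivalAux adj S t fuel (contract φ e))
      (length-filter-filter (T? ∘ crosses S) _ (edges adj))
      (All.map contraction-bound (all-filter _ (edges adj)))
    where
    contraction-bound : ∀ {e} → T (not ⌊ φ (proj₁ e) F.≟ φ (proj₂ e) ⌋) →
      Σ ℕ λ L → L < classCount φ × r ^ L ≤ℚ survivalAux adj S t fuel (contract φ e)
    contraction-bound {u , v} u≁v =
      classCount ψ , classCount-decreases , survival-≥ fuel ψ contract-idempotent
      where open Contraction idem (toWitnessFalse u≁v)

  -- Karger's algorithm starts from n singleton classes, so the cut survives
  -- with probability at least r^n.
  survivalProb-≥ : r ^ suc k ≤ℚ survivalProb adj S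
  survivalProb-≥ = ℚP.≤-trans (^-antitone r-nonneg r-≤1 (classCount-≤ {suc k} id))
    (survival-≥ (length (edges adj)) id (λ _ → refl))

two-vertices : ∀ {n} {S : VSet n} → NonemptyProper S → 2 ≤ n
two-vertices {zero} ((() , _) , _)
two-vertices {suc zero} ((F.zero , Sx) , (F.zero , Sy)) = contradiction (trans (sym Sx) Sy) λ ()
two-vertices {suc (suc m)} _ = s≤s (s≤s z≤n)

lemma2p4 : Σ ℚ λ δ → (0ℚ <ℚ δ) × ((n : ℕ) (adj : Adj n) → (∀ u v → adj u v ≡ adj v u) → (∀ u → adj u u ≡ false) → (C : VSet n) → IsMinCut adj C → 1 ≤ cutValue adj C → δ ≤ℚ survivalProb adj C)
lemma2p4 = recip 9 , recip-positive 9 , ninth≤survival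
  where
  ninth≤survival : (n : ℕ) (adj : Adj n) → (∀ u v → adj u v ≡ adj v u) → (∀ u → adj u u ≡ false) →
    (C : VSet n) → IsMinCut adj C → 1 ≤ cutValue adj C → recip 9 ≤ℚ survivalProb adj C
  ninth≤survival n adj _ _ C (C-proper , _) _ with two-vertices C-proper
  ... | s≤s (s≤s {n = m} _) = ℚP.≤-trans (ninth≤survivalRatio^n m) (Survival.survivalProb-≥ {suc m} adj C)
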